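{- Let $\Theta$ be a substitution schema and $\mathcal{U}$ a finite set of unification equations. If $\mathrm{store}_\Theta(\mathcal{U})\neq\bot$, then $\mathcal{U}$ is unifiable (in the usual syntactic first-order sense).
   Context: Variables are objects $X_i$ with $X$ from a countably infinite set $\mathcal{V}_{sym}$ of variable symbols and $i\in\mathbb{N}$; terms are first-order terms over a signature $\Sigma$ and these variables; $\mathrm{cls}(X_i)=\{X\}$. $\mathrm{shift}_d$ adds $d$ to every variable index in a term. A substitution schema $\Theta$ is given by pairwise distinct symbols $X^1,\dots,X^n$ and terms $t_1,\dots,t_n$, and is the infinite mapping $\{X^i_j\mapsto\mathrm{shift}_j(t_i)\mid 1\le i\le n, j\ge0\}$, with $\mathrm{dom}(\Theta)=\{X^1,\dots,X^n\}$. For a variable $x$ write $x\in\Theta$ if $\mathrm{cls}(x)\subseteq\mathrm{dom}(\Theta)$, and $x\notin\Theta$ otherwise. For a term $t$, $\Theta^t$ is the substitution sending each variable $x$ of $t$ with $x\in\Theta$ to its image under $\Theta$ and fixing all other variables; $\Theta^t(0)=t$ and $\Theta^t(k+1)=s\Theta^s$ with $s=\Theta^t(k)$. $\Theta$-unification. A configuration is a pair $(\mathcal{S},\mathcal{U})$ of sets of equations (store, active set). Starting from $(\emptyset,\mathcal{U})$, the procedure first saturates the active set under: Decomposition (replace $f(r_1,\dots,r_n)\stackrel{?}{=}f(s_1,\dots,s_n)$ by the $r_i\stackrel{?}{=}s_i$); Orient-1 (replace $r\stackrel{?}{=}x$, $x$ a variable, $r$ not a variable, by $x\stackrel{?}{=}r$);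 Orient-2 (for variables, if $y\stackrel{?}{=}x$ is present and $x\stackrel{?}{=}y$ not, add $x\stackrel{?}{=}y$); Transitivity (from $x\stackrel{?}{=}r$, $x\stackrel{?}{=}s$, $x$ a variable, $r\ne s$, add $r\stackrel{?}{=}s$); Reflexive (remove $t\stackrel{?}{=}t$); Clash (an equation between non-variable terms with different heads makes the procedure fail). Then Store is applied as long as possible, moving $y\stackrel{?}{=}r$ ($y$ a variable) from the active set to the store if (1) $y\in\Theta$ and, if $r$ is a variable, $r\in\Theta$; or (2) $y\notin\Theta$ and some $x\stackrel{?}{=}s'$ in the store has $y$ occurring in $s'$, or $r=x$, or $y=x$; or (3) $y\notin\Theta$ and for some variable $z\in\Theta$ occurring in the store and some $k\ge0$, $y$ occurs in $\Theta^z(k)$. Finally syntactic unification is run on store $\cup$ active set and the procedure fails if it fails (clash or occurs check). The resulting configuration is the final configuration $\mathrm{fin}_\Theta(\mathcal{U})$ and its store is $\mathrm{store}_\Theta(\mathcal{U})$; if the procedure fails, $\mathrm{store}_\Theta(\mathcal{U})=\bot$. -}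

module Defs where

open import Data.Nat using (ℕ; _+_)
open import Data.Fin using (Fin)
open import Data.Bool using (Bool; true; false)
open import Data.Product using (Σ; ∃; _×_; _,_; proj₁; proj₂)
open import Data.Product.Properties using (≡-dec)
open import Data.Sum using (_⊎_)
open import Data.Maybe using (Maybe; just; nothing)
open import Data.List using (List; []; _∷_; _++_; map)
open import Data.Vec using (Vec; lookup)
import Data.Vec as V
open import Data.List.Membership.Propositional using (_∈_; _∉_)
open import Data.List.Relation.Unary.Unique.Propositional using (Unique)
open import Data.List.Relation.Binary.Permutation.Propositional using (_↭_)
open import Relation.Binary.Construct.Closure.ReflexiveTransitive using (Star)
open import Relation.Binary.PropositionalEquality using (_≡_; _≢_)
open import Relation.Nullary using (¬_; yes; no)
import Data.Nat as N

record Signature : Set₁ where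
  field
    Fun   : Set
    arity : Fun → ℕ
open Signature public

-- Variable symbols: the countably infinite set ℕ.
-- A variable X_i is the pair (X , i); cls(X_i) = {X}.
VSym : Set
VSym = ℕ

Var : Set
Var = VSym × ℕ

_≟ᵥ_ : (x y : Var) → Relation.Nullary.Dec (x ≡ y)
_≟ᵥ_ = ≡-dec N._≟_ N._≟_

data Term (S : Signature) : Set where
  var : Var → Term S
  fun : (f : Fun S) → Vec (Term S) (arity S f) → Term S

Subst : Signature → Set
Subst S = Var → Term S

mutual
  sub : {S : Signature} → Subst S → Term S → Term S
  sub σ (var x)    = σ x
  sub σ (fun f ts) = fun f (subs σ ts)

  subs : {S : Signature} {n : ℕ} → Subst S → Vec (Term S) n → Vec (Term S) n
  subs σ V.[]       = V.[]
  subs σ (t V.∷ ts) = sub σ t V.∷ subs σ ts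

data _occursIn_ {S : Signature} (x : Var) : Term S → Set where
  here : x occursIn var x
  arg  : ∀ {f ts} (i : Fin (arity S f)) → x occursIn lookup ts i → x occursIn fun f ts

IsVar : {S : Signature} → Term S → Set
IsVar t = ∃ λ x → t ≡ var x

shift : {S : Signature} → ℕ → Term S → Term S
shift d = sub (λ { (X , i) → var (X , i + d) })

Eqn : Signature → Set
Eqn S = Term S × Term S

Unifier : {S : Signature} → Subst S → List (Eqn S) → Set
Unifier σ E = ∀ {l r} → (l , r) ∈ E → sub σ l ≡ sub σ r

Unifiable : {S : Signature} → List (Eqn S) → Set
Unifiable {S} E = Σ (Subst S) λ σ → Unifier σ E

zipEqs : {S : Signature} {n : ℕ} → Vec (Term S) n → Vec (Term S) n → List (Eqn S)
zipEqs V.[]       V.[]       = []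
zipEqs (r V.∷ rs) (s V.∷ ss) = (r , s) ∷ zipEqs rs ss

record Schema (S : Signature) : Set where
  field
    pairs    : List (VSym × Term S)
    distinct : Unique (map proj₁ pairs)
open Schema public

dom : {S : Signature} → Schema S → List VSym
dom Θ = map proj₁ (pairs Θ)

-- x ∈ Θ  iff  cls(x) ⊆ dom(Θ)
_∈Θ_ : {S : Signature} → Var → Schema S → Set
x ∈Θ Θ = proj₁ x ∈ dom Θ

_∉Θ_ : {S : Signature} → Var → Schema S → Set
x ∉Θ Θ = ¬ (x ∈Θ Θ)

findSym : {S : Signature} → VSym → List (VSym × Term S) → Maybe (Term S)
findSym X [] = nothing
findSym X ((Y , t) ∷ ps) with X N.≟ Y
... | yes _ = just t
... | no  _ = findSym X ps

-- the substitution acting as Θ on variables x ∈ Θ (X^i_j ↦ shift_j(t_i))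
-- and as the identity on variables x ∉ Θ.  For every term t,
-- t Θ^t = sub (Θ̂ Θ) t.
Θ̂ : {S : Signature} → Schema S → Subst S
Θ̂ Θ (X , j) with findSym X (pairs Θ)
... | just t  = shift j t
... | nothing = var (X , j)

iterΘ : {S : Signature} → Schema S → Term S → ℕ → Term S
iterΘ Θ t ℕ.zero    = t
iterΘ Θ t (ℕ.suc k) = sub (Θ̂ Θ) (iterΘ Θ t k)

-- Phase 1: saturation rules on the active set (the store is empty)
data Step₁ {S : Signature} : List (Eqn S) → List (Eqn S) → Set where
  decomposition : ∀ {A B f} {rs ss : Vec (Term S) (arity S f)} →
    A ↭ ((fun f rs , fun f ss) ∷ B) → Step₁ A (zipEqs rs ss ++ B)
  orient-1 : ∀ {A B r x} → A ↭ ((r , var x) ∷ B) → ¬ IsVar r →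
    Step₁ A ((var x , r) ∷ B)
  orient-2 : ∀ {A x y} → (var y , var x) ∈ A → (var x , var y) ∉ A →
    Step₁ A ((var x , var y) ∷ A)
  transitivity : ∀ {A x r s} → (var x , r) ∈ A → (var x , s) ∈ A → r ≢ s →
    Step₁ A ((r , s) ∷ A)
  reflexive : ∀ {A B t} → A ↭ ((t , t) ∷ B) → Step₁ A B

Clash : {S : Signature} → Eqn S → Set
Clash {S} (l , r) = Σ (Fun S) λ f → Σ (Fun S) λ g → f ≢ g ×
  (∃ λ ts → l ≡ fun f ts) × (∃ λ us → r ≡ fun g us)

NoClash : {S : Signature} → List (Eqn S) → Set
NoClash E = ∀ {e} → e ∈ E → ¬ Clash e

_occursInEqs_ : {S : Signature} → Var → List (Eqn S) → Set
z occursInEqs E = ∃ λ l → ∃ λ r → (l , r) ∈ E × (z occursIn l ⊎ z occursIn r)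

StoreCond : {S : Signature} → Schema S → List (Eqn S) → Var → Term S → Set
StoreCond Θ 𝒮 y r =
    ((y ∈Θ Θ) × (∀ z → r ≡ var z → z ∈Θ Θ))
  ⊎ ((y ∉Θ Θ) × (∃ λ x → ∃ λ s′ → (var x , s′) ∈ 𝒮 ×
        (y occursIn s′ ⊎ r ≡ var x ⊎ y ≡ x)))
  ⊎ ((y ∉Θ Θ) × (∃ λ z → z ∈Θ Θ × z occursInEqs 𝒮 ×
        ∃ λ k → y occursIn iterΘ Θ (var z) k))

Config : Signature → Set
Config S = List (Eqn S) × List (Eqn S)   -- (store , active set)

data StoreStep {S : Signature} (Θ : Schema S) : Config S → Config S → Set where
  store : ∀ {𝒮 A B y r} → A ↭ ((var y , r) ∷ B) → StoreCond Θ 𝒮 y r →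
    StoreStep Θ (𝒮 , A) (((var y , r) ∷ 𝒮) , B)

-- Syntactic unification (Martelli–Montanari rules)
substVar : {S : Signature} → Var → Term S → Subst S
substVar x t z with z ≟ᵥ x
... | yes _ = t
... | no  _ = var z

substEq : {S : Signature} → Var → Term S → Eqn S → Eqn S
substEq x t (l , r) = sub (substVar x t) l , sub (substVar x t) r

data MMStep {S : Signature} : List (Eqn S) → List (Eqn S) → Set where
  delete : ∀ {E B t} → E ↭ ((t , t) ∷ B) → MMStep E B
  decompose : ∀ {E B f} {rs ss : Vec (Term S) (arity S f)} →
    E ↭ ((fun f rs , fun f ss) ∷ B) → MMStep E (zipEqs rs ss ++ B)
  orient : ∀ {E B t x} → E ↭ ((t , var x) ∷ B) → ¬ IsVar t →
    MMStep E ((var x , t) ∷ B)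
  eliminate : ∀ {E B x t} → E ↭ ((var x , t) ∷ B) → ¬ (x occursIn t) →
    x occursInEqs B → MMStep E ((var x , t) ∷ map (substEq x t) B)

Solved : {S : Signature} → List (Eqn S) → Set
Solved E = ∀ {l r} → (l , r) ∈ E → ∃ λ x → l ≡ var x ×
  (∀ {l′ r′} → (l′ , r′) ∈ E → ¬ (x occursIn r′)) ×
  (∀ {r′} → (var x , r′) ∈ E → r′ ≡ r)

SyntUnifSucceeds : {S : Signature} → List (Eqn S) → Set
SyntUnifSucceeds E = ∃ λ E′ → Star MMStep E E′ × Solved E′

-- A non-failing run of Θ-unification on 𝒰, ending in the final
-- configuration (𝒮 , A) with store 𝒮 = store_Θ(𝒰) ≠ ⊥.
record SuccessfulRun {S : Signature} (Θ : Schema S) (𝒰 : List (Eqn S)) : Set where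
  field
    active₁      : List (Eqn S)
    phase₁       : Star Step₁ 𝒰 active₁
    noClash      : NoClash active₁
    storeSet     : List (Eqn S)
    activeSet    : List (Eqn S)
    phase₂       : Star (StoreStep Θ) ([] , active₁) (storeSet , activeSet)
    storeMaximal : ∀ {y r} → (var y , r) ∈ activeSet → ¬ StoreCond Θ storeSet y r
    syntactic    : SyntUnifSucceeds (storeSet ++ activeSet)

StoreNotBot : {S : Signature} → Schema S → List (Eqn S) → Set
StoreNotBot Θ 𝒰 = SuccessfulRun Θ 𝒰

-- Each rule used in a run of Θ-unification (saturation, Store, and the
-- Martelli–Montanari rules of syntactic unification) removes only trivial
-- equations t ≟ t and otherwise permutes, adds, decomposes, reorients or
-- instantiates equations (x ≟ t by t for x); so every unifier of the
-- equations after a step also unifies those before it.  A successful run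
-- ends in a solved form x₁ ≟ t₁, …, xₙ ≟ tₙ, which is unified by xᵢ ↦ tᵢ
-- because no xᵢ occurs in any tⱼ; pulling this unifier back along the whole
-- run yields a unifier of 𝒰.
module Submission where

open import Defs
open import Data.List using (List; []; _∷_; _++_; map)
open import Data.Fin using (zero; suc)
open import Data.Vec using (Vec; lookup)
import Data.Vec as V
open import Data.Product using (∃; _×_; _,_; proj₁; proj₂)
open import Data.Empty using (⊥-elim)
open import Function using (id; _∘_)
open import Relation.Nullary using (yes; no)
open import Relation.Binary.PropositionalEquality
open import Data.List.Relation.Unary.Any using (here; there)
open import Data.List.Membership.Propositional using (_∈_; _∉_)
open import Data.List.Membership.Propositional.Properties using (∈-map⁺; ∈-++⁺ˡ; ∈-++⁺ʳ)
open import Data.List.Relation.Binary.Permutation.Propositional using (_↭_; ↭-trans)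
open import Data.List.Relation.Binary.Permutation.Propositional.Properties
  using (∈-resp-↭; ++⁺ˡ) renaming (shift to ↭-shift)
open import Relation.Binary.Construct.Closure.ReflexiveTransitive using (Star; ε; _◅_)

module _ {S : Signature} where

  mutual
    sub-cong : (σ τ : Subst S) (t : Term S) →
      (∀ z → z occursIn t → σ z ≡ τ z) → sub σ t ≡ sub τ t
    sub-cong σ τ (var x)    agree = agree x here
    sub-cong σ τ (fun f ts) agree =
      cong (fun f) (subs-cong σ τ ts (λ i z z∈tᵢ → agree z (arg i z∈tᵢ)))

    subs-cong : ∀ {n} (σ τ : Subst S) (ts : Vec (Term S) n) →
      (∀ i z → z occursIn lookup ts i → σ z ≡ τ z) → subs σ ts ≡ subs τ ts
    subs-cong σ τ V.[]       agree = refl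
    subs-cong σ τ (t V.∷ ts) agree =
      cong₂ V._∷_ (sub-cong σ τ t (agree zero)) (subs-cong σ τ ts (agree ∘ suc))

  mutual
    sub-identity : (t : Term S) → sub var t ≡ t
    sub-identity (var x)    = refl
    sub-identity (fun f ts) = cong (fun f) (subs-identity ts)

    subs-identity : ∀ {n} (ts : Vec (Term S) n) → subs var ts ≡ ts
    subs-identity V.[]       = refl
    subs-identity (t V.∷ ts) = cong₂ V._∷_ (sub-identity t) (subs-identity ts)

  mutual
    sub-sub : (σ ρ : Subst S) (t : Term S) → sub σ (sub ρ t) ≡ sub (sub σ ∘ ρ) t
    sub-sub σ ρ (var x)    = refl
    sub-sub σ ρ (fun f ts) = cong (fun f) (subs-subs σ ρ ts)

    subs-subs : ∀ {n} (σ ρ : Subst S) (ts : Vec (Term S) n) →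
      subs σ (subs ρ ts) ≡ subs (sub σ ∘ ρ) ts
    subs-subs σ ρ V.[]       = refl
    subs-subs σ ρ (t V.∷ ts) = cong₂ V._∷_ (sub-sub σ ρ t) (subs-subs σ ρ ts)

  sub-substVar : (σ : Subst S) (x : Var) (t : Term S) → σ x ≡ sub σ t →
    (s : Term S) → sub σ (sub (substVar x t) s) ≡ sub σ s
  sub-substVar σ x t σx≡σt s =
    trans (sub-sub σ (substVar x t) s) (sub-cong _ σ s (λ z _ → agree z))
    where
      agree : ∀ z → sub σ (substVar x t z) ≡ σ z
      agree z with z ≟ᵥ x
      ... | yes refl = sym σx≡σt
      ... | no  _    = refl

  Unifier-resp-↭ : ∀ {σ : Subst S} {A B} → A ↭ B → Unifier σ B → Unifier σ A
  Unifier-resp-↭ A↭B u e∈A = u (∈-resp-↭ A↭B e∈A)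

  Unifier-∷⁺ : ∀ {σ : Subst S} {l r B} →
    sub σ l ≡ sub σ r → Unifier σ B → Unifier σ ((l , r) ∷ B)
  Unifier-∷⁺ σl≡σr u (here refl) = σl≡σr
  Unifier-∷⁺ σl≡σr u (there e∈B) = u e∈B

  Unifier-∷⁻ : ∀ {σ : Subst S} {e B} → Unifier σ (e ∷ B) → Unifier σ B
  Unifier-∷⁻ u = u ∘ there

  Unifier-swap : ∀ {σ : Subst S} {l r B} →
    Unifier σ ((r , l) ∷ B) → Unifier σ ((l , r) ∷ B)
  Unifier-swap u = Unifier-∷⁺ (sym (u (here refl))) (Unifier-∷⁻ u)

  Unifier-zipEqs⁻ : ∀ {σ : Subst S} {n} (rs ss : Vec (Term S) n) →
    Unifier σ (zipEqs rs ss) → subs σ rs ≡ subs σ ss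
  Unifier-zipEqs⁻ V.[]       V.[]       u = refl
  Unifier-zipEqs⁻ (r V.∷ rs) (s V.∷ ss) u =
    cong₂ V._∷_ (u (here refl)) (Unifier-zipEqs⁻ rs ss (Unifier-∷⁻ u))

  Unifier-decompose : ∀ {σ : Subst S} {f B} (rs ss : Vec (Term S) (arity S f)) →
    Unifier σ (zipEqs rs ss ++ B) → Unifier σ ((fun f rs , fun f ss) ∷ B)
  Unifier-decompose rs ss u =
    Unifier-∷⁺ (cong (fun _) (Unifier-zipEqs⁻ rs ss (u ∘ ∈-++⁺ˡ)))
               (u ∘ ∈-++⁺ʳ (zipEqs rs ss))

  Unifier-substEq⁻ : ∀ {σ : Subst S} {x t} B → σ x ≡ sub σ t →
    Unifier σ (map (substEq x t) B) → Unifier σ B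
  Unifier-substEq⁻ {σ} {x} {t} B σx≡σt u {l} {r} lr∈B =
    begin
      sub σ l                       ≡⟨ sub-substVar σ x t σx≡σt l ⟨
      sub σ (sub (substVar x t) l)  ≡⟨ u (∈-map⁺ (substEq x t) lr∈B) ⟩
      sub σ (sub (substVar x t) r)  ≡⟨ sub-substVar σ x t σx≡σt r ⟩
      sub σ r                       ∎
    where open ≡-Reasoning

  ReflectsUnifiers : {C : Set} → (C → List (Eqn S)) → (C → C → Set) → Set
  ReflectsUnifiers eqns R =
    ∀ {σ c c′} → R c c′ → Unifier σ (eqns c′) → Unifier σ (eqns c)

  Star-reflectsUnifiers : {C : Set} {eqns : C → List (Eqn S)} {R : C → C → Set} →
    ReflectsUnifiers eqns R → ReflectsUnifiers eqns (Star R)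
  Star-reflectsUnifiers reflects ε              u = u
  Star-reflectsUnifiers reflects (step ◅ steps) u =
    reflects step (Star-reflectsUnifiers reflects steps u)

  Step₁-reflectsUnifiers : ReflectsUnifiers id (Step₁ {S})
  Step₁-reflectsUnifiers (decomposition {rs = rs} {ss} A↭) u =
    Unifier-resp-↭ A↭ (Unifier-decompose rs ss u)
  Step₁-reflectsUnifiers (orient-1 A↭ _)       u = Unifier-resp-↭ A↭ (Unifier-swap u)
  Step₁-reflectsUnifiers (orient-2 _ _)        u = Unifier-∷⁻ u
  Step₁-reflectsUnifiers (transitivity _ _ _)  u = Unifier-∷⁻ u
  Step₁-reflectsUnifiers (reflexive A↭)        u = Unifier-resp-↭ A↭ (Unifier-∷⁺ refl u)

  configEqns : Config S → List (Eqn S)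
  configEqns (𝒮 , A) = 𝒮 ++ A

  StoreStep-reflectsUnifiers : (Θ : Schema S) → ReflectsUnifiers configEqns (StoreStep Θ)
  StoreStep-reflectsUnifiers Θ (store {𝒮} {B = B} {y} {r} A↭ _) =
    Unifier-resp-↭ (↭-trans (++⁺ˡ 𝒮 A↭) (↭-shift (var y , r) 𝒮 B))

  MMStep-reflectsUnifiers : ReflectsUnifiers id (MMStep {S})
  MMStep-reflectsUnifiers (delete E↭)                   u =
    Unifier-resp-↭ E↭ (Unifier-∷⁺ refl u)
  MMStep-reflectsUnifiers (decompose {rs = rs} {ss} E↭) u =
    Unifier-resp-↭ E↭ (Unifier-decompose rs ss u)
  MMStep-reflectsUnifiers (orient E↭ _)                 u =
    Unifier-resp-↭ E↭ (Unifier-swap u)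
  MMStep-reflectsUnifiers (eliminate {B = B} E↭ _ _)    u =
    Unifier-resp-↭ E↭
      (Unifier-∷⁺ (u (here refl)) (Unifier-substEq⁻ B (u (here refl)) (Unifier-∷⁻ u)))

  solvedSubst : List (Eqn S) → Subst S
  solvedSubst []                   z = var z
  solvedSubst ((var y , r) ∷ E)    z with y ≟ᵥ z
  ... | yes _ = r
  ... | no  _ = solvedSubst E z
  solvedSubst ((fun _ _ , _) ∷ E)  z = solvedSubst E z

  solvedSubst-∈ : ∀ E {z r} → (var z , r) ∈ E →
    ∃ λ r′ → (var z , r′) ∈ E × solvedSubst E z ≡ r′
  solvedSubst-∈ ((var y , r₀) ∷ E) {z} zr∈E with y ≟ᵥ z
  ... | yes refl = r₀ , here refl , refl
  solvedSubst-∈ ((var y , r₀) ∷ E) (here refl)  | no y≢z = ⊥-elim (y≢z refl)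
  solvedSubst-∈ ((var y , r₀) ∷ E) (there zr∈E) | no _   with solvedSubst-∈ E zr∈E
  ... | r′ , zr′∈E , eq = r′ , there zr′∈E , eq
  solvedSubst-∈ ((fun _ _ , _) ∷ E) (there zr∈E) with solvedSubst-∈ E zr∈E
  ... | r′ , zr′∈E , eq = r′ , there zr′∈E , eq

  solvedSubst-∉ : ∀ E {z} → (∀ {r} → (var z , r) ∉ E) → solvedSubst E z ≡ var z
  solvedSubst-∉ []                  z∉E = refl
  solvedSubst-∉ ((var y , r) ∷ E) {z} z∉E with y ≟ᵥ z
  ... | yes refl = ⊥-elim (z∉E (here refl))
  ... | no  _    = solvedSubst-∉ E (z∉E ∘ there)
  solvedSubst-∉ ((fun _ _ , _) ∷ E) z∉E = solvedSubst-∉ E (z∉E ∘ there)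

  solved⇒unifier : ∀ E → Solved E → Unifier (solvedSubst E) E
  solved⇒unifier E solved {l} {r} lr∈E with solved lr∈E
  ... | x , refl , _ , functional = trans σx≡r (sym σr≡r)
    where
      σx≡r : solvedSubst E x ≡ r
      σx≡r with solvedSubst-∈ E lr∈E
      ... | r′ , xr′∈E , eq = trans eq (functional xr′∈E)

      unbound : ∀ z → z occursIn r → ∀ {r″} → (var z , r″) ∉ E
      unbound z z∈r zr″∈E with solved zr″∈E
      ... | _ , refl , notInRhs′ , _ = notInRhs′ lr∈E z∈r

      σr≡r : sub (solvedSubst E) r ≡ r
      σr≡r = trans (sub-cong _ var r (λ z z∈r → solvedSubst-∉ E (unbound z z∈r)))
                   (sub-identity r)

  syntUnifSucceeds⇒unifiable : ∀ {E : List (Eqn S)} → SyntUnifSucceeds E → Unifiable E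
  syntUnifSucceeds⇒unifiable (E′ , steps , solved) =
    solvedSubst E′ ,
    Star-reflectsUnifiers MMStep-reflectsUnifiers steps (solved⇒unifier E′ solved)

theorem4 : (S : Signature) (Θ : Schema S) (𝒰 : List (Eqn S)) →
    StoreNotBot Θ 𝒰 → Unifiable 𝒰
theorem4 S Θ 𝒰 run =
  σ , Star-reflectsUnifiers Step₁-reflectsUnifiers phase₁
        (Star-reflectsUnifiers (StoreStep-reflectsUnifiers Θ) phase₂ unifiesFinal)
  where
    open SuccessfulRun run
    finalUnifiable : Unifiable (storeSet ++ activeSet)
    finalUnifiable = syntUnifSucceeds⇒unifiable syntactic
    σ : Subst S
    σ = proj₁ finalUnifiable
    unifiesFinal : Unifier σ (storeSet ++ activeSet)
    unifiesFinal = proj₂ finalUnifiable
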